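{- Let $(U,\mathcal{F},\kappa)$ be an instance of \textsc{Hitting Set} with $|U|=n$, $0\le\kappa\le n$, and let $G$ be the graph with vertices $m_F$ ($F\in\mathcal{F}$), $v_u$ ($u\in U$; $Q_1=\{v_u:u\in U\}$), a set $Q_2$ of $n-\kappa$ further vertices, and $m_1,m_2$, where $Q_1$ and $Q_2$ are cliques, $m_1,m_2$ are adjacent to each other and to all of $Q_1\cup Q_2$, $N_G(m_F)=\{v_u:u\in F\}$, and there are no other edges. Then $(U,\mathcal{F},\kappa)$ is a yes-instance of \textsc{Hitting Set} if and only if there exists a dominator coloring $\chi$ of $G$ using exactly $n+2$ colors such that $\chi(m_1)=\chi(m_F)$ for all $F\in\mathcal{F}$.
   Context: \textsc{Hitting Set}: given $U$, $\mathcal{F}\subseteq 2^U$ and $\kappa$, decide whether some $S\subseteq U$ with $|S|\le\kappa$ meets every $F\in\mathcal{F}$. A dominator coloring of $G$ is a proper coloring in which every vertex $v$ dominates some color class (the class is contained in $N_G[v]=N_G(v)\cup\{v\}$). -}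

module Defs where

open import Data.Nat using (ℕ; _+_; _∸_; _≤_)
open import Data.Fin using (Fin)
open import Data.Fin.Subset using (Subset; _∈_; ∣_∣)
open import Data.Product using (Σ; ∃; _×_)
open import Data.Sum using (_⊎_)
open import Data.Unit using (⊤)
open import Data.Empty using (⊥)
open import Relation.Binary.PropositionalEquality using (_≡_; _≢_)

-- Hitting Set.  U = Fin n; the family 𝓕 is given as k subsets
-- 𝓕 : Fin k → Subset n (required injective in the theorem, so it is a set).

IsHittingSet : ∀ {n k} → (Fin k → Subset n) → Subset n → Set
IsHittingSet {n} {k} 𝓕 S = ∀ (F : Fin k) → ∃ λ (u : Fin n) → u ∈ S × u ∈ 𝓕 F

YesInstance : ∀ {n k} → (Fin k → Subset n) → ℕ → Set
YesInstance {n} 𝓕 κ = Σ (Subset n) λ S → ∣ S ∣ ≤ κ × IsHittingSet 𝓕 S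

IsProper : {V C : Set} → (V → V → Set) → (V → C) → Set
IsProper {V} Adj χ = ∀ (x y : V) → Adj x y → χ x ≢ χ y

DominatesClass : {V C : Set} → (V → V → Set) → (V → C) → V → C → Set
DominatesClass {V} Adj χ v c = ∀ (w : V) → χ w ≡ c → (w ≡ v ⊎ Adj v w)

IsDominatorColoring : {V C : Set} → (V → V → Set) → (V → C) → Set
IsDominatorColoring {V} {C} Adj χ =
  IsProper Adj χ ×
  (∀ (v : V) → Σ C λ c → (∃ λ (w : V) → χ w ≡ c) × DominatesClass Adj χ v c)

-- a colouring χ : V → Fin m uses exactly m colours iff it is onto
UsesAllColours : {V : Set} {m : ℕ} → (V → Fin m) → Set
UsesAllColours {V} {m} χ = ∀ (c : Fin m) → ∃ λ (x : V) → χ x ≡ c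

data Vtx (n k κ : ℕ) : Set where
  mF : Fin k → Vtx n k κ
  vU : Fin n → Vtx n k κ
  q2 : Fin (n ∸ κ) → Vtx n k κ
  m₁ : Vtx n k κ
  m₂ : Vtx n k κ

Adj : ∀ {n k κ} → (Fin k → Subset n) → Vtx n k κ → Vtx n k κ → Set
Adj 𝓕 (mF F) (vU u) = u ∈ 𝓕 F
Adj 𝓕 (vU u) (mF F) = u ∈ 𝓕 F
Adj 𝓕 (vU u) (vU u′) = u ≢ u′
Adj 𝓕 (q2 i) (q2 j) = i ≢ j
Adj 𝓕 m₁ m₂ = ⊤
Adj 𝓕 m₂ m₁ = ⊤
Adj 𝓕 m₁ (vU _) = ⊤
Adj 𝓕 m₁ (q2 _) = ⊤
Adj 𝓕 m₂ (vU _) = ⊤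
Adj 𝓕 m₂ (q2 _) = ⊤
Adj 𝓕 (vU _) m₁ = ⊤
Adj 𝓕 (q2 _) m₁ = ⊤
Adj 𝓕 (vU _) m₂ = ⊤
Adj 𝓕 (q2 _) m₂ = ⊤
Adj 𝓕 _ _ = ⊥

{-# OPTIONS --safe #-}
-- A hitting set S of size at most κ gives the colouring: Q₁ receives n distinct
-- colours, Q₂ reuses n − κ colours of Q₁-vertices outside S, m₁ and every m_F
-- share one extra colour and m₂ gets the last one.  Then m_F dominates the
-- singleton class {v_u} of any u ∈ S ∩ F, and all other vertices dominate {m₂}.
--
-- Conversely, m_F cannot dominate its own class (it contains m₁), so it
-- dominates a class containing some v_u with u ∈ F and no vertex of Q₂.  Hence
-- the set S of those u whose colour does not appear on Q₂ hits every F, and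
-- the colours of m₁, m₂, of v_u for u ∈ S and of Q₂ are pairwise distinct,
-- giving 2 + |S| + (n − κ) ≤ n + 2.
module Submission where

open import Defs
open import Data.Nat using (ℕ; _+_; _≤_)
open import Data.Fin using (Fin)
open import Data.Fin.Subset using (Subset)
open import Data.Product using (Σ; _×_; _,_)
open import Function.Definitions using (Injective)
open import Relation.Binary.PropositionalEquality using (_≡_)
open import Function.Bundles using (_⇔_)

open import Data.Nat using (_∸_)
import Data.Nat.Properties as ℕ
open import Data.Fin as Fin using (zero; suc; _↑ˡ_; _↑ʳ_; splitAt; inject≤)
open import Data.Fin.Properties
  using (suc-injective; ↑ˡ-injective; ↑ʳ-injective; splitAt-↑ˡ; splitAt-↑ʳ; splitAt⁻¹-↑ˡ; splitAt⁻¹-↑ʳ;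
         inject≤-injective; injective⇒≤; all?; _≟_)
open import Data.Fin.Subset using (_∈_; _∉_; ∣_∣; inside; outside; ∁)
open import Data.Fin.Subset.Properties using (x∈∁p⇒x∉p; ∣∁p∣≡n∸∣p∣)
open import Data.Vec using (_∷_; here; there; tabulate)
open import Data.Vec.Properties using (lookup∘tabulate; lookup⇒[]=; []=⇒lookup)
open import Data.Vec.Functional as Vector using (Vector; _++_)
open import Data.Sum using (_⊎_; inj₁; inj₂)
open import Data.Product using (∃)
open import Data.Unit using (tt)
open import Data.Empty using (⊥-elim)
open import Function using (_∘_)
open import Relation.Nullary using (¬_; yes; no; does; ¬?)
open import Relation.Nullary.Decidable using (dec-true)
open import Level using (0ℓ)
open import Relation.Unary using (Pred; Decidable)
open import Relation.Binary.PropositionalEquality using (_≢_; refl; sym; trans; cong; subst)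
open import Function.Bundles using (mk⇔)

module _ {a} {A : Set a} where

  ∷-injective : ∀ {n} {x : A} {xs : Vector A n} →
                (∀ i → x ≢ xs i) → Injective _≡_ _≡_ xs → Injective _≡_ _≡_ (x Vector.∷ xs)
  ∷-injective x∉xs xs-inj {zero}  {zero}  _ = refl
  ∷-injective x∉xs xs-inj {zero}  {suc j} e = ⊥-elim (x∉xs j e)
  ∷-injective x∉xs xs-inj {suc i} {zero}  e = ⊥-elim (x∉xs i (sym e))
  ∷-injective x∉xs xs-inj {suc i} {suc j} e = cong suc (xs-inj e)

  ∉-++ : ∀ {m n} {x : A} {xs : Vector A m} {ys : Vector A n} →
         (∀ i → x ≢ xs i) → (∀ j → x ≢ ys j) → ∀ k → x ≢ (xs ++ ys) k
  ∉-++ {m} x∉xs x∉ys k with splitAt m k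
  ... | inj₁ i = x∉xs i
  ... | inj₂ j = x∉ys j

  disjoint-++-injective : ∀ {m n} {xs : Vector A m} {ys : Vector A n} →
    Injective _≡_ _≡_ xs → Injective _≡_ _≡_ ys → (∀ i j → xs i ≢ ys j) →
    Injective _≡_ _≡_ (xs ++ ys)
  disjoint-++-injective {m} {n} xs-inj ys-inj disjoint {k} {l} e
    with splitAt m k in k≡ | splitAt m l in l≡
  ... | inj₁ i | inj₁ j = trans (sym (splitAt⁻¹-↑ˡ k≡)) (trans (cong (_↑ˡ n) (xs-inj e)) (splitAt⁻¹-↑ˡ l≡))
  ... | inj₂ i | inj₂ j = trans (sym (splitAt⁻¹-↑ʳ k≡)) (trans (cong (m ↑ʳ_) (ys-inj e)) (splitAt⁻¹-↑ʳ l≡))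
  ... | inj₁ i | inj₂ j = ⊥-elim (disjoint i j e)
  ... | inj₂ i | inj₁ j = ⊥-elim (disjoint j i (sym e))

↑ˡ≢↑ʳ : ∀ {m n} (i : Fin m) (j : Fin n) → i ↑ˡ n ≢ m ↑ʳ j
↑ˡ≢↑ʳ {m} {n} i j e with trans (sym (splitAt-↑ˡ m i n)) (trans (cong (splitAt m) e) (splitAt-↑ʳ m n j))
... | ()

enumerate : ∀ {n} (p : Subset n) → Fin ∣ p ∣ → Fin n
enumerate (inside  ∷ p) zero    = zero
enumerate (inside  ∷ p) (suc i) = suc (enumerate p i)
enumerate (outside ∷ p) i       = suc (enumerate p i)

enumerate-∈ : ∀ {n} (p : Subset n) i → enumerate p i ∈ p
enumerate-∈ (inside  ∷ p) zero    = here
enumerate-∈ (inside  ∷ p) (suc i) = there (enumerate-∈ p i)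
enumerate-∈ (outside ∷ p) i       = there (enumerate-∈ p i)

enumerate-injective : ∀ {n} (p : Subset n) → Injective _≡_ _≡_ (enumerate p)
enumerate-injective (inside  ∷ p) {zero}  {zero}  _ = refl
enumerate-injective (inside  ∷ p) {suc i} {suc j} e = cong suc (enumerate-injective p (suc-injective e))
enumerate-injective (outside ∷ p)                 e = enumerate-injective p (suc-injective e)

module _ {n ℓ} {P : Pred (Fin n) ℓ} (P? : Decidable P) where

  subsetOf : Subset n
  subsetOf = tabulate (does ∘ P?)

  ∈-subsetOf⁺ : ∀ {u} → P u → u ∈ subsetOf
  ∈-subsetOf⁺ {u} Pu = lookup⇒[]= u subsetOf (trans (lookup∘tabulate _ u) (dec-true (P? u) Pu))

  ∈-subsetOf⁻ : ∀ {u} → u ∈ subsetOf → P u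
  ∈-subsetOf⁻ {u} u∈ with P? u | trans (sym (lookup∘tabulate (does ∘ P?) u)) ([]=⇒lookup u∈)
  ... | yes Pu | _  = Pu
  ... | no  _  | ()

proper⇒injective-on-clique : ∀ {V C : Set} {Adj : V → V → Set} {χ : V → C} {m} →
  IsProper Adj χ → (f : Fin m → V) → (∀ {i j} → i ≢ j → Adj (f i) (f j)) →
  Injective _≡_ _≡_ (χ ∘ f)
proper⇒injective-on-clique proper f clique {i} {j} e with i ≟ j
... | yes i≡j = i≡j
... | no  i≢j = ⊥-elim (proper (f i) (f j) (clique i≢j) e)

module Reduction (n k κ : ℕ) (𝓕 : Fin k → Subset n) where

  _∈N[_] : Vtx n k κ → Vtx n k κ → Set
  w ∈N[ v ] = w ≡ v ⊎ Adj 𝓕 v w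

  module Forward (S : Subset n) (∣S∣≤κ : ∣ S ∣ ≤ κ) (S-hits : IsHittingSet 𝓕 S) where

    n∸κ≤∣∁S∣ : n ∸ κ ≤ ∣ ∁ S ∣
    n∸κ≤∣∁S∣ = subst (n ∸ κ ≤_) (sym (∣∁p∣≡n∸∣p∣ S)) (ℕ.∸-monoʳ-≤ n ∣S∣≤κ)

    outsideS : Fin (n ∸ κ) → Fin n
    outsideS j = enumerate (∁ S) (inject≤ j n∸κ≤∣∁S∣)

    outsideS-injective : Injective _≡_ _≡_ outsideS
    outsideS-injective {i} {j} =
      inject≤-injective n∸κ≤∣∁S∣ n∸κ≤∣∁S∣ i j ∘ enumerate-injective (∁ S)

    outsideS-∉ : ∀ j → outsideS j ∉ S
    outsideS-∉ j = x∈∁p⇒x∉p (enumerate-∈ (∁ S) (inject≤ j n∸κ≤∣∁S∣))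

    ι : Fin n → Fin (n + 2)
    ι u = u ↑ˡ 2

    c₁ c₂ : Fin (n + 2)
    c₁ = n ↑ʳ zero
    c₂ = n ↑ʳ suc zero

    c₁≢c₂ : c₁ ≢ c₂
    c₁≢c₂ e with ↑ʳ-injective n zero (suc zero) e
    ... | ()

    χ : Vtx n k κ → Fin (n + 2)
    χ (mF F) = c₁
    χ (vU u) = ι u
    χ (q2 j) = ι (outsideS j)
    χ m₁     = c₁
    χ m₂     = c₂

    proper : IsProper (Adj 𝓕) χ
    proper (mF F) (vU u) _ e = ↑ˡ≢↑ʳ u _ (sym e)
    proper (vU u) (mF F) _ e = ↑ˡ≢↑ʳ u _ e
    proper (vU u) (vU u′) u≢u′ e = u≢u′ (↑ˡ-injective 2 u u′ e)
    proper (q2 i) (q2 j) i≢j e = i≢j (outsideS-injective (↑ˡ-injective 2 _ _ e))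
    proper m₁ m₂ _ = c₁≢c₂
    proper m₂ m₁ _ = c₁≢c₂ ∘ sym
    proper m₁ (vU u) _ e = ↑ˡ≢↑ʳ u _ (sym e)
    proper m₁ (q2 j) _ e = ↑ˡ≢↑ʳ (outsideS j) _ (sym e)
    proper m₂ (vU u) _ e = ↑ˡ≢↑ʳ u _ (sym e)
    proper m₂ (q2 j) _ e = ↑ˡ≢↑ʳ (outsideS j) _ (sym e)
    proper (vU u) m₁ _ e = ↑ˡ≢↑ʳ u _ e
    proper (q2 j) m₁ _ e = ↑ˡ≢↑ʳ (outsideS j) _ e
    proper (vU u) m₂ _ e = ↑ˡ≢↑ʳ u _ e
    proper (q2 j) m₂ _ e = ↑ˡ≢↑ʳ (outsideS j) _ e

    class-c₂ : ∀ w → χ w ≡ c₂ → w ≡ m₂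
    class-c₂ (mF F) e = ⊥-elim (c₁≢c₂ e)
    class-c₂ (vU u) e = ⊥-elim (↑ˡ≢↑ʳ u _ e)
    class-c₂ (q2 j) e = ⊥-elim (↑ˡ≢↑ʳ (outsideS j) _ e)
    class-c₂ m₁     e = ⊥-elim (c₁≢c₂ e)
    class-c₂ m₂     _ = refl

    dominates-c₂ : ∀ v → m₂ ∈N[ v ] → DominatesClass (Adj 𝓕) χ v c₂
    dominates-c₂ v m₂∈N[v] w e with class-c₂ w e
    ... | refl = m₂∈N[v]

    dominates-ι : ∀ F u → u ∈ S → u ∈ 𝓕 F → DominatesClass (Adj 𝓕) χ (mF F) (ι u)
    dominates-ι F u u∈S u∈F (vU u′) e with ↑ˡ-injective 2 u′ u e
    ... | refl = inj₂ u∈F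
    dominates-ι F u u∈S u∈F (q2 j) e with ↑ˡ-injective 2 (outsideS j) u e
    ... | refl = ⊥-elim (outsideS-∉ j u∈S)
    dominates-ι F u u∈S u∈F (mF G) e = ⊥-elim (↑ˡ≢↑ʳ u _ (sym e))
    dominates-ι F u u∈S u∈F m₁     e = ⊥-elim (↑ˡ≢↑ʳ u _ (sym e))
    dominates-ι F u u∈S u∈F m₂     e = ⊥-elim (↑ˡ≢↑ʳ u _ (sym e))

    dominator : ∀ v → Σ (Fin (n + 2)) λ c → (∃ λ w → χ w ≡ c) × DominatesClass (Adj 𝓕) χ v c
    dominator (mF F) with S-hits F
    ... | u , u∈S , u∈F = ι u , (vU u , refl) , dominates-ι F u u∈S u∈F
    dominator (vU u) = c₂ , (m₂ , refl) , dominates-c₂ (vU u) (inj₂ tt)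
    dominator (q2 j) = c₂ , (m₂ , refl) , dominates-c₂ (q2 j) (inj₂ tt)
    dominator m₁     = c₂ , (m₂ , refl) , dominates-c₂ m₁ (inj₂ tt)
    dominator m₂     = c₂ , (m₂ , refl) , dominates-c₂ m₂ (inj₁ refl)

    onto : UsesAllColours χ
    onto c with splitAt n c in c≡
    ... | inj₁ u          = vU u , splitAt⁻¹-↑ˡ c≡
    ... | inj₂ zero       = m₁   , splitAt⁻¹-↑ʳ c≡
    ... | inj₂ (suc zero) = m₂   , splitAt⁻¹-↑ʳ c≡

    colouring : Σ (Vtx n k κ → Fin (n + 2)) λ χ →
      IsDominatorColoring (Adj 𝓕) χ × UsesAllColours χ × (∀ F → χ m₁ ≡ χ (mF F))
    colouring = χ , (proper , dominator) , onto , λ _ → refl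

  module Backward (κ≤n : κ ≤ n) (χ : Vtx n k κ → Fin (n + 2)) (proper : IsProper (Adj 𝓕) χ)
                  (dominator : ∀ v → Σ (Fin (n + 2)) λ c →
                                 (∃ λ w → χ w ≡ c) × DominatesClass (Adj 𝓕) χ v c)
                  (χm₁≡χmF : ∀ F → χ m₁ ≡ χ (mF F)) where

    ColourUnusedOnQ₂ : Pred (Fin n) 0ℓ
    ColourUnusedOnQ₂ u = ∀ j → χ (q2 j) ≢ χ (vU u)

    colourUnusedOnQ₂? : Decidable ColourUnusedOnQ₂
    colourUnusedOnQ₂? u = all? (λ j → ¬? (χ (q2 j) ≟ χ (vU u)))

    S : Subset n
    S = subsetOf colourUnusedOnQ₂?

    colours : Vector (Fin (n + 2)) (2 + (∣ S ∣ + (n ∸ κ)))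
    colours = χ m₁ Vector.∷ χ m₂ Vector.∷ (χ ∘ vU ∘ enumerate S ++ χ ∘ q2)

    colours-injective : Injective _≡_ _≡_ colours
    colours-injective = ∷-injective m₁∉ (∷-injective m₂∉ (disjoint-++-injective S-inj Q₂-inj disjoint))
      where
      S-inj : Injective _≡_ _≡_ (χ ∘ vU ∘ enumerate S)
      S-inj = proper⇒injective-on-clique proper (vU ∘ enumerate S) (λ i≢j → i≢j ∘ enumerate-injective S)
      Q₂-inj : Injective _≡_ _≡_ (χ ∘ q2)
      Q₂-inj = proper⇒injective-on-clique proper q2 (λ i≢j → i≢j)
      disjoint : ∀ i j → χ (vU (enumerate S i)) ≢ χ (q2 j)
      disjoint i j e = ∈-subsetOf⁻ colourUnusedOnQ₂? (enumerate-∈ S i) j (sym e)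
      m₂∉ : ∀ i → χ m₂ ≢ (χ ∘ vU ∘ enumerate S ++ χ ∘ q2) i
      m₂∉ = ∉-++ (λ i → proper m₂ (vU (enumerate S i)) tt) (λ j → proper m₂ (q2 j) tt)
      m₁∉ : ∀ i → χ m₁ ≢ (χ m₂ Vector.∷ (χ ∘ vU ∘ enumerate S ++ χ ∘ q2)) i
      m₁∉ zero    = proper m₁ m₂ tt
      m₁∉ (suc i) = ∉-++ (λ i → proper m₁ (vU (enumerate S i)) tt) (λ j → proper m₁ (q2 j) tt) i

    ∣S∣+[n∸κ]≤n : ∣ S ∣ + (n ∸ κ) ≤ n
    ∣S∣+[n∸κ]≤n = ℕ.+-cancelˡ-≤ 2 _ _
      (subst (2 + (∣ S ∣ + (n ∸ κ)) ≤_) (ℕ.+-comm n 2) (injective⇒≤ colours-injective))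

    ∣S∣≤κ : ∣ S ∣ ≤ κ
    ∣S∣≤κ = ℕ.+-cancelʳ-≤ (n ∸ κ) ∣ S ∣ κ
      (subst (∣ S ∣ + (n ∸ κ) ≤_) (sym (ℕ.m+[n∸m]≡n κ≤n)) ∣S∣+[n∸κ]≤n)

    m₁∉N[mF] : ∀ {F} → ¬ (m₁ ∈N[ mF F ])
    m₁∉N[mF] (inj₁ ())
    m₁∉N[mF] (inj₂ ())

    q2∉N[mF] : ∀ {F j} → ¬ (q2 j ∈N[ mF F ])
    q2∉N[mF] (inj₁ ())
    q2∉N[mF] (inj₂ ())

    S-hits : IsHittingSet 𝓕 S
    S-hits F with dominator (mF F)
    ... | c , (w , χw≡c) , dom with dom w χw≡c
    ... | inj₁ refl = ⊥-elim (m₁∉N[mF] (dom m₁ (trans (χm₁≡χmF F) χw≡c)))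
    S-hits F | c , (vU u , χw≡c) , dom | inj₂ u∈F =
      u , ∈-subsetOf⁺ colourUnusedOnQ₂? (λ j e → q2∉N[mF] (dom (q2 j) (trans e χw≡c))) , u∈F
    S-hits F | c , (mF _ , _) , _ | inj₂ ()
    S-hits F | c , (q2 _ , _) , _ | inj₂ ()
    S-hits F | c , (m₁ , _)   , _ | inj₂ ()
    S-hits F | c , (m₂ , _)   , _ | inj₂ ()

lemma5 : (n k κ : ℕ) → (𝓕 : Fin k → Subset n) → Injective _≡_ _≡_ 𝓕 → κ ≤ n →
    YesInstance 𝓕 κ ⇔
    (Σ (Vtx n k κ → Fin (n + 2)) λ χ →
      IsDominatorColoring (Adj 𝓕) χ × UsesAllColours χ ×
      (∀ (F : Fin k) → χ m₁ ≡ χ (mF F)))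
lemma5 n k κ 𝓕 _ κ≤n = mk⇔
  (λ { (S , ∣S∣≤κ , S-hits) → Forward.colouring S ∣S∣≤κ S-hits })
  (λ { (χ , (proper , dominator) , _ , χm₁≡χmF) →
         let open Backward κ≤n χ proper dominator χm₁≡χmF in S , ∣S∣≤κ , S-hits })
  where open Reduction n k κ 𝓕
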